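{- For any $A \in V^{ss}_{\mathbb{Z}}$, the stabilizer group $\mathrm{Stab}(A)$ in $B'_2(\mathbb{Z}) \times B'_2(\mathbb{Z}) \times \mathrm{SL}_2(\mathbb{Z})$ is $\{ (I_2, I_2, I_2)\}$, where $I_2$ is the $2\times 2$ identity matrix. Therefore $|\mathrm{Stab}(A)| =1$ for any $A \in V^{ss}_{\mathbb{Z}}$.
   Context: $V_{\mathbb{Z}}$ is the set of $2\times2\times2$ integer cubes $A = \left( \left( \begin{smallmatrix} a & b \\ c & d \end{smallmatrix} \right), \left( \begin{smallmatrix} e & f \\ g & h \end{smallmatrix} \right) \right)$; the $i$-th factor of $B'_2(\mathbb{Z}) \times B'_2(\mathbb{Z}) \times \mathrm{SL}_2(\mathbb{Z})$ acts on the pair $(M_i,N_i)$ of opposite faces, $(M_1,N_1)=(\left(\begin{smallmatrix} a&b\\ c&d\end{smallmatrix}\right),\left(\begin{smallmatrix} e&f\\ g&h\end{smallmatrix}\right))$, $(M_2,N_2)=(\left(\begin{smallmatrix} a&c\\ e&g\end{smallmatrix}\right),\left(\begin{smallmatrix} b&d\\ f&h\end{smallmatrix}\right))$, $(M_3,N_3)=(\left(\begin{smallmatrix} a&e\\ b&f\end{smallmatrix}\right),\left(\begin{smallmatrix} c&g\\ d&h\end{smallmatrix}\right))$, with $\left(\begin{smallmatrix} g_{11}&g_{12}\\ g_{21}&g_{22}\end{smallmatrix}\right)$ sending $(M,N)$ to $(g_{11}M+g_{12}N, g_{21}M+g_{22}N)$. $B'_2(\mathbb{Z})$ is the group of lower-triangular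 matrices in $\mathrm{SL}_2(\mathbb{Z})$ with positive diagonal entries. $V^{ss}_{\mathbb{Z}}$ is the set of cubes for which $ad-bc$, $ag-ce$ and $\mathrm{disc}(A)=(-ah+bg+cf-de)^2-4(ad-bc)(eh-fg)$ are all nonzero. -}

module Defs where

open import Data.Integer using (ℤ; _+_; _*_; _-_; +_; 0ℤ; 1ℤ; _>_)
open import Data.Product using (_×_; _,_)
open import Relation.Binary.PropositionalEquality using (_≡_; _≢_)

record Mat2 : Set where
  constructor mat
  field
    m11 m12 m21 m22 : ℤ

det : Mat2 → ℤ
det (mat p q r s) = p * s - q * r

I₂ : Mat2
I₂ = mat 1ℤ 0ℤ 0ℤ 1ℤ

IsSL2 : Mat2 → Set
IsSL2 m = det m ≡ 1ℤ

IsB2' : Mat2 → Set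
IsB2' m = IsSL2 m × Mat2.m12 m ≡ 0ℤ × Mat2.m11 m > 0ℤ × Mat2.m22 m > 0ℤ

-- A cube ((a b ; c d), (e f ; g h)), stored as a b c d e f g h
record Cube : Set where
  constructor cube
  field
    a b c d e f g h : ℤ

-- (g11 M + g12 N , g21 M + g22 N) on entries: given an entry x of M and the
-- corresponding entry y of N
lin₁ : Mat2 → ℤ → ℤ → ℤ
lin₁ (mat p q _ _) x y = p * x + q * y

lin₂ : Mat2 → ℤ → ℤ → ℤ
lin₂ (mat _ _ r s) x y = r * x + s * y

-- Factor 1: (M₁,N₁) = ((a b ; c d), (e f ; g h)); entries a↔e, b↔f, c↔g, d↔h
act₁ : Mat2 → Cube → Cube
act₁ γ (cube a b c d e f g h) =
  cube (lin₁ γ a e) (lin₁ γ b f) (lin₁ γ c g) (lin₁ γ d h)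
       (lin₂ γ a e) (lin₂ γ b f) (lin₂ γ c g) (lin₂ γ d h)

-- Factor 2: (M₂,N₂) = ((a c ; e g), (b d ; f h)); entries a↔b, c↔d, e↔f, g↔h
act₂ : Mat2 → Cube → Cube
act₂ γ (cube a b c d e f g h) =
  cube (lin₁ γ a b) (lin₂ γ a b) (lin₁ γ c d) (lin₂ γ c d)
       (lin₁ γ e f) (lin₂ γ e f) (lin₁ γ g h) (lin₂ γ g h)

-- Factor 3: (M₃,N₃) = ((a e ; b f), (c g ; d h)); entries a↔c, b↔d, e↔g, f↔h
act₃ : Mat2 → Cube → Cube
act₃ γ (cube a b c d e f g h) =
  cube (lin₁ γ a c) (lin₁ γ b d) (lin₂ γ a c) (lin₂ γ b d)
       (lin₁ γ e g) (lin₁ γ f h) (lin₂ γ e g) (lin₂ γ f h)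

-- Action of (γ₁, γ₂, γ₃) ∈ B'₂(ℤ) × B'₂(ℤ) × SL₂(ℤ) (the three factors commute)
act : Mat2 → Mat2 → Mat2 → Cube → Cube
act γ₁ γ₂ γ₃ A = act₁ γ₁ (act₂ γ₂ (act₃ γ₃ A))

disc : Cube → ℤ
disc (cube a b c d e f g h) =
  let t = ((Data.Integer.- (a * h)) + b * g + c * f) - d * e in
  t * t - (+ 4) * ((a * d - b * c) * (e * h - f * g))

IsVss : Cube → Set
IsVss A@(cube a b c d e f g h) =
  (a * d - b * c ≢ 0ℤ) × (a * g - c * e ≢ 0ℤ) × (disc A ≢ 0ℤ)

-- Write the cube as the 2×4 matrix with columns (a,c), (b,d), (e,g), (f,h). The SL₂ factor
-- multiplies it on the left, so it fixes every 2×2 minor. An element of B'₂(ℤ) has positive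
-- diagonal entries with product 1, so it is a shear (1 0 ; x 1), and the two shears move the
-- minors b g − e d and a h − f c by y (a g − c e) − x (a d − b c) and y (a g − c e) + x (a d − b c)
-- respectively. For a fixed cube both shifts vanish, which forces x = y = 0; the SL₂ element then
-- fixes the independent columns (a,c) and (e,g), hence is the identity.
module Submission where

open import Defs
open import Data.Integer using (ℤ; _+_; _*_; _-_; +_; -[1+_]; 0ℤ; 1ℤ; ≢-nonZero)
open import Data.Integer.Properties
  using (+-identityˡ; +-identityʳ; *-identityˡ; *-comm; *-cancelʳ-≡; pos-*; +-injective;
         i≡j⇒i-j≡0; i-j≡0⇒i≡j; +-0-abelianGroup)
open import Algebra.Properties.AbelianGroup +-0-abelianGroup using (identityʳ-unique)
open import Data.Integer.Tactic.RingSolver using (solve-∀)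
import Data.Nat as ℕ
open import Data.Nat.Properties using (m*n≡1⇒m≡1; m*n≡1⇒n≡1)
open import Data.Product using (_×_; _,_; proj₁; proj₂; ∃-syntax)
open import Relation.Binary.PropositionalEquality
  using (_≡_; _≢_; refl; sym; trans; cong; cong₂; subst₂; module ≡-Reasoning)

open ≡-Reasoning

i*j≡0⇒i≡0 : ∀ i {j} → j ≢ 0ℤ → i * j ≡ 0ℤ → i ≡ 0ℤ
i*j≡0⇒i≡0 i {j} j≢0 = *-cancelʳ-≡ i 0ℤ j {{≢-nonZero j≢0}}

shifts-vanish : ∀ {m n v w} → (m + v) - w ≡ m → (n + v) + w ≡ n → v ≡ 0ℤ × w ≡ 0ℤ
shifts-vanish {m} {n} {v} {w} m-shift n-shift = v≡0 , w≡0
  where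
    v-w≡0 : v - w ≡ 0ℤ
    v-w≡0 = identityʳ-unique m (v - w) (trans (reassoc m v w) m-shift)
      where
        reassoc : ∀ m v w → m + (v - w) ≡ (m + v) - w
        reassoc = solve-∀
    v+w≡0 : v + w ≡ 0ℤ
    v+w≡0 = identityʳ-unique n (v + w) (trans (reassoc n v w) n-shift)
      where
        reassoc : ∀ n v w → n + (v + w) ≡ (n + v) + w
        reassoc = solve-∀
    v≡0 : v ≡ 0ℤ
    v≡0 = i*j≡0⇒i≡0 v (λ ()) (begin
      v * + 2               ≡⟨ double v w ⟩
      (v + w) + (v - w)     ≡⟨ cong₂ _+_ v+w≡0 v-w≡0 ⟩
      0ℤ                    ∎)
      where
        double : ∀ v w → v * + 2 ≡ (v + w) + (v - w)
        double = solve-∀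
    w≡0 : w ≡ 0ℤ
    w≡0 = trans (sym (i-j≡0⇒i≡j v w v-w≡0)) v≡0

lower : ℤ → Mat2
lower x = mat 1ℤ 0ℤ x 1ℤ

IsB2'⇒≡lower : ∀ γ → IsB2' γ → ∃[ x ] γ ≡ lower x
IsB2'⇒≡lower (mat (+ m) _ r (+ n)) (det≡1 , refl , _ , _) =
  r , cong₂ (λ p s → mat p 0ℤ r s) (cong +_ (m*n≡1⇒m≡1 m n m*n≡1)) (cong +_ (m*n≡1⇒n≡1 m n m*n≡1))
  where
    m*n≡1 : m ℕ.* n ≡ 1
    m*n≡1 = +-injective (begin
      + (m ℕ.* n)          ≡⟨ pos-* m n ⟩
      + m * + n            ≡⟨ sym (+-identityʳ _) ⟩
      + m * + n - 0ℤ * r   ≡⟨ det≡1 ⟩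
      1ℤ                   ∎)
IsB2'⇒≡lower (mat -[1+ _ ] _ _ _) (_ , _ , () , _)
IsB2'⇒≡lower (mat (+ _) _ _ -[1+ _ ]) (_ , _ , _ , ())

ℤ² : Set
ℤ² = ℤ × ℤ

_·_ : Mat2 → ℤ² → ℤ²
γ · (u₁ , u₂) = lin₁ γ u₁ u₂ , lin₂ γ u₁ u₂

ω : ℤ² → ℤ² → ℤ
ω (u₁ , u₂) (v₁ , v₂) = u₁ * v₂ - v₁ * u₂

ω-· : ∀ γ u v → ω (γ · u) (γ · v) ≡ det γ * ω u v
ω-· (mat p q r s) (u₁ , u₂) (v₁ , v₂) = identity p q r s u₁ u₂ v₁ v₂
  where
    identity : ∀ p q r s u₁ u₂ v₁ v₂ →
      (p * u₁ + q * u₂) * (r * v₁ + s * v₂) - (p * v₁ + q * v₂) * (r * u₁ + s * u₂)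
        ≡ (p * s - q * r) * (u₁ * v₂ - v₁ * u₂)
    identity = solve-∀

ω-·-SL₂ : ∀ γ → IsSL2 γ → ∀ u v → ω (γ · u) (γ · v) ≡ ω u v
ω-·-SL₂ γ det≡1 u v = trans (ω-· γ u v) (trans (cong (_* ω u v) det≡1) (*-identityˡ (ω u v)))

annihilates-independent⇒≡0 : ∀ {z w u₁ u₂ v₁ v₂} → ω (u₁ , u₂) (v₁ , v₂) ≢ 0ℤ →
  z * u₁ + w * u₂ ≡ 0ℤ → z * v₁ + w * v₂ ≡ 0ℤ → z ≡ 0ℤ × w ≡ 0ℤ
annihilates-independent⇒≡0 {z} {w} {u₁} {u₂} {v₁} {v₂} ω≢0 zu≡0 zv≡0 =
  i*j≡0⇒i≡0 z ω≢0 (begin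
    z * ω (u₁ , u₂) (v₁ , v₂)                 ≡⟨ cramer₁ z w u₁ u₂ v₁ v₂ ⟩
    v₂ * (z * u₁ + w * u₂) - u₂ * (z * v₁ + w * v₂)
                                              ≡⟨ cong₂ (λ s t → v₂ * s - u₂ * t) zu≡0 zv≡0 ⟩
    v₂ * 0ℤ - u₂ * 0ℤ                         ≡⟨ annul v₂ u₂ ⟩
    0ℤ                                        ∎) ,
  i*j≡0⇒i≡0 w ω≢0 (begin
    w * ω (u₁ , u₂) (v₁ , v₂)                 ≡⟨ cramer₂ z w u₁ u₂ v₁ v₂ ⟩
    u₁ * (z * v₁ + w * v₂) - v₁ * (z * u₁ + w * u₂)
                                              ≡⟨ cong₂ (λ s t → u₁ * s - v₁ * t) zv≡0 zu≡0 ⟩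
    u₁ * 0ℤ - v₁ * 0ℤ                         ≡⟨ annul u₁ v₁ ⟩
    0ℤ                                        ∎)
  where
    cramer₁ : ∀ z w u₁ u₂ v₁ v₂ →
      z * (u₁ * v₂ - v₁ * u₂) ≡ v₂ * (z * u₁ + w * u₂) - u₂ * (z * v₁ + w * v₂)
    cramer₁ = solve-∀
    cramer₂ : ∀ z w u₁ u₂ v₁ v₂ →
      w * (u₁ * v₂ - v₁ * u₂) ≡ u₁ * (z * v₁ + w * v₂) - v₁ * (z * u₁ + w * u₂)
    cramer₂ = solve-∀
    annul : ∀ s t → s * 0ℤ - t * 0ℤ ≡ 0ℤ
    annul = solve-∀

·-fixes-independent⇒≡I₂ : ∀ γ u v → ω u v ≢ 0ℤ → γ · u ≡ u → γ · v ≡ v → γ ≡ I₂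
·-fixes-independent⇒≡I₂ (mat p q r s) (u₁ , u₂) (v₁ , v₂) ω≢0 γu≡u γv≡v =
  entries (i-j≡0⇒i≡j p 1ℤ (proj₁ first-row≡0)) (proj₂ first-row≡0)
          (proj₁ second-row≡0) (i-j≡0⇒i≡j s 1ℤ (proj₂ second-row≡0))
  where
    first-row : ∀ {t₁ t₂} → p * t₁ + q * t₂ ≡ t₁ → (p - 1ℤ) * t₁ + q * t₂ ≡ 0ℤ
    first-row {t₁} {t₂} fixed = trans (identity p q t₁ t₂) (i≡j⇒i-j≡0 fixed)
      where
        identity : ∀ p q t₁ t₂ → (p - 1ℤ) * t₁ + q * t₂ ≡ (p * t₁ + q * t₂) - t₁
        identity = solve-∀
    second-row : ∀ {t₁ t₂} → r * t₁ + s * t₂ ≡ t₂ → r * t₁ + (s - 1ℤ) * t₂ ≡ 0ℤ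
    second-row {t₁} {t₂} fixed = trans (identity r s t₁ t₂) (i≡j⇒i-j≡0 fixed)
      where
        identity : ∀ r s t₁ t₂ → r * t₁ + (s - 1ℤ) * t₂ ≡ (r * t₁ + s * t₂) - t₂
        identity = solve-∀
    first-row≡0 : p - 1ℤ ≡ 0ℤ × q ≡ 0ℤ
    first-row≡0 = annihilates-independent⇒≡0 ω≢0
      (first-row (cong proj₁ γu≡u)) (first-row (cong proj₁ γv≡v))
    second-row≡0 : r ≡ 0ℤ × s - 1ℤ ≡ 0ℤ
    second-row≡0 = annihilates-independent⇒≡0 ω≢0
      (second-row (cong proj₂ γu≡u)) (second-row (cong proj₂ γv≡v))
    entries : ∀ {p q r s} → p ≡ 1ℤ → q ≡ 0ℤ → r ≡ 0ℤ → s ≡ 1ℤ → mat p q r s ≡ I₂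
    entries refl refl refl refl = refl

lin₁-lower : ∀ x u v → lin₁ (lower x) u v ≡ u
lin₁-lower x u v = trans (+-identityʳ (1ℤ * u)) (*-identityˡ u)

lin₂-lower : ∀ x u v → lin₂ (lower x) u v ≡ x * u + v
lin₂-lower x u v = cong (_+_ (x * u)) (*-identityˡ v)

lin₁-I₂ : ∀ u v → lin₁ I₂ u v ≡ u
lin₁-I₂ = lin₁-lower 0ℤ

lin₂-I₂ : ∀ u v → lin₂ I₂ u v ≡ v
lin₂-I₂ u v = trans (lin₂-lower 0ℤ u v) (+-identityˡ v)

act₁-lower : ∀ x a b c d e f g h → act₁ (lower x) (cube a b c d e f g h)
  ≡ cube a b c d (x * a + e) (x * b + f) (x * c + g) (x * d + h)
act₁-lower x a b c d e f g h
  rewrite lin₁-lower x a e | lin₁-lower x b f | lin₁-lower x c g | lin₁-lower x d h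
        | lin₂-lower x a e | lin₂-lower x b f | lin₂-lower x c g | lin₂-lower x d h = refl

act₂-lower : ∀ y a b c d e f g h → act₂ (lower y) (cube a b c d e f g h)
  ≡ cube a (y * a + b) c (y * c + d) e (y * e + f) g (y * g + h)
act₂-lower y a b c d e f g h
  rewrite lin₁-lower y a b | lin₁-lower y c d | lin₁-lower y e f | lin₁-lower y g h
        | lin₂-lower y a b | lin₂-lower y c d | lin₂-lower y e f | lin₂-lower y g h = refl

act₁-I₂ : ∀ A → act₁ I₂ A ≡ A
act₁-I₂ (cube a b c d e f g h)
  rewrite lin₁-I₂ a e | lin₁-I₂ b f | lin₁-I₂ c g | lin₁-I₂ d h
        | lin₂-I₂ a e | lin₂-I₂ b f | lin₂-I₂ c g | lin₂-I₂ d h = refl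

act₂-I₂ : ∀ A → act₂ I₂ A ≡ A
act₂-I₂ (cube a b c d e f g h)
  rewrite lin₁-I₂ a b | lin₁-I₂ c d | lin₁-I₂ e f | lin₁-I₂ g h
        | lin₂-I₂ a b | lin₂-I₂ c d | lin₂-I₂ e f | lin₂-I₂ g h = refl

act-I₂-I₂ : ∀ γ A → act I₂ I₂ γ A ≡ act₃ γ A
act-I₂-I₂ γ A = trans (act₁-I₂ (act₂ I₂ (act₃ γ A))) (act₂-I₂ (act₃ γ A))

-- The 2×2 minors of the 2×4 matrix with columns (a,c), (b,d), (e,g), (f,h), on which the
-- SL₂ factor acts by left multiplication; minor₁₂ = det M₁ and minor₁₃ = det M₂.
minor₁₂ minor₁₃ minor₂₃ minor₁₄ : Cube → ℤ
minor₁₂ (cube a b c d e f g h) = ω (a , c) (b , d)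
minor₁₃ (cube a b c d e f g h) = ω (a , c) (e , g)
minor₂₃ (cube a b c d e f g h) = ω (b , d) (e , g)
minor₁₄ (cube a b c d e f g h) = ω (a , c) (f , h)

minor₁₂-act₂ : ∀ y A → minor₁₂ (act₂ (lower y) A) ≡ minor₁₂ A
minor₁₂-act₂ y (cube a b c d e f g h) =
  trans (cong minor₁₂ (act₂-lower y a b c d e f g h)) (identity y a b c d)
  where
    identity : ∀ y a b c d → a * (y * c + d) - (y * a + b) * c ≡ a * d - b * c
    identity = solve-∀

minor₂₃-act₂ : ∀ y A → minor₂₃ (act₂ (lower y) A) ≡ minor₂₃ A + y * minor₁₃ A
minor₂₃-act₂ y (cube a b c d e f g h) =
  trans (cong minor₂₃ (act₂-lower y a b c d e f g h)) (identity y a b c d e g)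
  where
    identity : ∀ y a b c d e g →
      (y * a + b) * g - e * (y * c + d) ≡ (b * g - e * d) + y * (a * g - e * c)
    identity = solve-∀

minor₁₄-act₂ : ∀ y A → minor₁₄ (act₂ (lower y) A) ≡ minor₁₄ A + y * minor₁₃ A
minor₁₄-act₂ y (cube a b c d e f g h) =
  trans (cong minor₁₄ (act₂-lower y a b c d e f g h)) (identity y a c e f g h)
  where
    identity : ∀ y a c e f g h →
      a * (y * g + h) - (y * e + f) * c ≡ (a * h - f * c) + y * (a * g - e * c)
    identity = solve-∀

minor₂₃-act₁ : ∀ x A → minor₂₃ (act₁ (lower x) A) ≡ minor₂₃ A - x * minor₁₂ A
minor₂₃-act₁ x (cube a b c d e f g h) =
  trans (cong minor₂₃ (act₁-lower x a b c d e f g h)) (identity x a b c d e g)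
  where
    identity : ∀ x a b c d e g →
      b * (x * c + g) - (x * a + e) * d ≡ (b * g - e * d) - x * (a * d - b * c)
    identity = solve-∀

minor₁₄-act₁ : ∀ x A → minor₁₄ (act₁ (lower x) A) ≡ minor₁₄ A + x * minor₁₂ A
minor₁₄-act₁ x (cube a b c d e f g h) =
  trans (cong minor₁₄ (act₁-lower x a b c d e f g h)) (identity x a b c d f h)
  where
    identity : ∀ x a b c d f h →
      a * (x * d + h) - (x * b + f) * c ≡ (a * h - f * c) + x * (a * d - b * c)
    identity = solve-∀

minor₂₃-act : ∀ x y γ A → IsSL2 γ →
  minor₂₃ (act (lower x) (lower y) γ A) ≡ (minor₂₃ A + y * minor₁₃ A) - x * minor₁₂ A
minor₂₃-act x y γ A@(cube a b c d e f g h) det≡1 = begin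
  minor₂₃ (act₁ (lower x) C)                    ≡⟨ minor₂₃-act₁ x C ⟩
  minor₂₃ C - x * minor₁₂ C                     ≡⟨ cong₂ (λ s t → s - x * t)
                                                     (minor₂₃-act₂ y B) (minor₁₂-act₂ y B) ⟩
  (minor₂₃ B + y * minor₁₃ B) - x * minor₁₂ B   ≡⟨ cong₂ (λ s t → s - x * t)
                                                     (cong₂ (λ s t → s + y * t)
                                                       (invariant (b , d) (e , g))
                                                       (invariant (a , c) (e , g)))
                                                     (invariant (a , c) (b , d)) ⟩
  (minor₂₃ A + y * minor₁₃ A) - x * minor₁₂ A   ∎
  where
    B C : Cube
    B = act₃ γ A
    C = act₂ (lower y) B
    invariant : ∀ u v → ω (γ · u) (γ · v) ≡ ω u v
    invariant = ω-·-SL₂ γ det≡1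

minor₁₄-act : ∀ x y γ A → IsSL2 γ →
  minor₁₄ (act (lower x) (lower y) γ A) ≡ (minor₁₄ A + y * minor₁₃ A) + x * minor₁₂ A
minor₁₄-act x y γ A@(cube a b c d e f g h) det≡1 = begin
  minor₁₄ (act₁ (lower x) C)                    ≡⟨ minor₁₄-act₁ x C ⟩
  minor₁₄ C + x * minor₁₂ C                     ≡⟨ cong₂ (λ s t → s + x * t)
                                                     (minor₁₄-act₂ y B) (minor₁₂-act₂ y B) ⟩
  (minor₁₄ B + y * minor₁₃ B) + x * minor₁₂ B   ≡⟨ cong₂ (λ s t → s + x * t)
                                                     (cong₂ (λ s t → s + y * t)
                                                       (invariant (a , c) (f , h))
                                                       (invariant (a , c) (e , g)))
                                                     (invariant (a , c) (b , d)) ⟩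
  (minor₁₄ A + y * minor₁₃ A) + x * minor₁₂ A   ∎
  where
    B C : Cube
    B = act₃ γ A
    C = act₂ (lower y) B
    invariant : ∀ u v → ω (γ · u) (γ · v) ≡ ω u v
    invariant = ω-·-SL₂ γ det≡1

proposition3p2 : (A : Cube) → IsVss A →
    (γ₁ γ₂ γ₃ : Mat2) → IsB2' γ₁ → IsB2' γ₂ → IsSL2 γ₃ →
    act γ₁ γ₂ γ₃ A ≡ A →
    (γ₁ ≡ I₂) × (γ₂ ≡ I₂) × (γ₃ ≡ I₂)
proposition3p2 A@(cube a b c d e f g h) (minor₁₂≢0 , ag-ce≢0 , _) γ₁ γ₂ γ₃ γ₁∈B'₂ γ₂∈B'₂ det≡1 fixed
  with IsB2'⇒≡lower γ₁ γ₁∈B'₂ | IsB2'⇒≡lower γ₂ γ₂∈B'₂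
... | x , refl | y , refl = cong lower x≡0 , cong lower y≡0 , γ₃≡I₂
  where
    minor₁₃≢0 : minor₁₃ A ≢ 0ℤ
    minor₁₃≢0 = λ eq → ag-ce≢0 (trans (cong (_-_ (a * g)) (*-comm c e)) eq)
    shifts≡0 : y * minor₁₃ A ≡ 0ℤ × x * minor₁₂ A ≡ 0ℤ
    shifts≡0 = shifts-vanish
      (trans (sym (minor₂₃-act x y γ₃ A det≡1)) (cong minor₂₃ fixed))
      (trans (sym (minor₁₄-act x y γ₃ A det≡1)) (cong minor₁₄ fixed))
    x≡0 : x ≡ 0ℤ
    x≡0 = i*j≡0⇒i≡0 x minor₁₂≢0 (proj₂ shifts≡0)
    y≡0 : y ≡ 0ℤ
    y≡0 = i*j≡0⇒i≡0 y minor₁₃≢0 (proj₁ shifts≡0)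
    γ₃-fixes : act₃ γ₃ A ≡ A
    γ₃-fixes = trans (sym (act-I₂-I₂ γ₃ A))
                     (subst₂ (λ x y → act (lower x) (lower y) γ₃ A ≡ A) x≡0 y≡0 fixed)
    γ₃≡I₂ : γ₃ ≡ I₂
    γ₃≡I₂ = ·-fixes-independent⇒≡I₂ γ₃ (a , c) (e , g) minor₁₃≢0
      (cong₂ _,_ (cong Cube.a γ₃-fixes) (cong Cube.c γ₃-fixes))
      (cong₂ _,_ (cong Cube.e γ₃-fixes) (cong Cube.g γ₃-fixes))
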